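{- For $0 \leq k \leq n-1$, $h_k(X) \geq \frac{1}{\theta_k}$.
   Context: All homology and cohomology is with $\mathbb{F}_2$ coefficients. Let $X$ be a finite $n$-dimensional pure simplicial complex, $X(k)$ its set of $k$-faces, $f_k(X)=|X(k)|$. For $\sigma\in X(k)$ let $c(\sigma)$ be the number of $n$-faces containing $\sigma$ and $w(\sigma)=\frac{c(\sigma)}{\binom{n+1}{k+1}f_n(X)}$. For $\phi\in C^k(X)$, $\|\phi\|=\sum_{\sigma:\phi(\sigma)\neq0}w(\sigma)$, $\|[\phi]\|=\min_{\psi\in C^{k-1}(X)}\|\phi+d_{k-1}\psi\|$, and $h_k(X)=\min\{\|d_k\phi\|/\|[\phi]\|:\phi\in C^k(X)\setminus B^k(X)\}$. Let $(X,S,G,\mathcal{B})$ be an $n$-dimensional building-like complex: $G\le\mathrm{Aut}(X)$, $S$ a finite $G$-set, $\mathcal{F}_k=S\times X(k)$ ($-1\le k\le n-1$, with $k=-1$ corresponding to the empty simplex), $\mathcal{B}=\{B_{s,\tau}\}$ subcomplexes with $\tau\in B_{s,\tau}\subset B_{s,\tau'}$ for $\tau\subset\tau'$, such that $G$ is transitive on $X(n)$, $gB_{s,\tau}=B_{gs,g\tau}$, and $\tilde H_i(B_{s,\tau})=0$ for $(s,\tau)\in\mathcal{F}_k$, $-1\le i\le k<n$. Let $\mathcal{C}=\{c_{s,\tau}\in C_{k+1}(B_{s,\tau}):-1\le k\le n-1,(s,\tau)\in\mathcal{F}_k\}$ be a family of chains (which exists by the acyclicity of the $B_{s,\tau}$)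 satisfying $\partial_{k+1}c_{s,\tau}=\tau+\sum_{i=0}^k c_{s,\tau_i}$, where for $\tau=(v_0,\dots,v_k)$, $\tau_i$ is $\tau$ with $v_i$ removed. For $\eta\in X(k+1)$ let $$\lambda(\eta)=\frac{1}{|S|\,w(\eta)}\sum_{\{(s,\tau)\in\mathcal{F}_k:\ \eta\in\mathrm{supp}(c_{s,\tau})\}}w(\tau),$$ and $\theta_k=\theta_k(X,\mathcal{C})=\max_{\eta\in X(k+1)}\lambda(\eta)$. -}

module Defs where

open import Data.Bool using (Bool; true; false; _∧_; _∨_; _xor_; not; if_then_else_)
open import Data.Nat as ℕ using (ℕ; zero; suc; _≡ᵇ_)
open import Data.Nat.Combinatorics using (_C_)
open import Data.Fin using (Fin)
open import Data.Fin.Subset using (Subset; ∣_∣)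
open import Data.Vec as Vec using (Vec; []; _∷_; lookup; tabulate)
open import Data.List as List using (List; []; _∷_; map; _++_; foldr; length; allFin; concatMap; filterᵇ)
open import Data.Bool.ListAction using (any)
open import Data.List.Membership.Propositional using (_∈_)
open import Data.List.Relation.Unary.All using (All)
open import Data.Integer using (+_)
open import Data.Rational as ℚ using (ℚ; 0ℚ; _+_; _*_; _÷_; _⊓_; _⊔_; _≤_)
open import Data.Rational.Properties using (_≟_)
open import Data.Product using (Σ; _×_; _,_; ∃; ∃-syntax)
open import Relation.Binary.PropositionalEquality using (_≡_; _≢_)
open import Relation.Nullary using (¬_; yes; no)

parity : List Bool → Bool
parity = foldr _xor_ false

sumℚ : List ℚ → ℚ
sumℚ = foldr _+_ 0ℚ

-- minimum / maximum of a list of rationals (value 0 on the empty list,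
-- which never occurs where these are used)
minℚ : List ℚ → ℚ
minℚ []       = 0ℚ
minℚ (x ∷ xs) = foldr _⊓_ x xs

maxℚ : List ℚ → ℚ
maxℚ []       = 0ℚ
maxℚ (x ∷ xs) = foldr _⊔_ x xs

ℕ→ℚ : ℕ → ℚ
ℕ→ℚ a = + a ℚ./ 1

-- division of rationals, with the (never used) convention p / 0 = 0
_÷₀_ : ℚ → ℚ → ℚ
p ÷₀ q with q ≟ 0ℚ
... | yes _  = 0ℚ
... | no q≢0 = _÷_ p q {{ℚ.≢-nonZero q≢0}}

-- all sublists of a list (used to enumerate all cochains on a finite set)
sublists : ∀ {a} {A : Set a} → List A → List (List A)
sublists []       = [] ∷ []
sublists (x ∷ xs) = let r = sublists xs in r ++ map (x ∷_) r

-- Subsets of the vertex set Fin N (= simplices, the empty one included)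

allSubsets : (N : ℕ) → List (Subset N)
allSubsets zero    = [] ∷ []
allSubsets (suc N) = map (false ∷_) (allSubsets N) ++ map (true ∷_) (allSubsets N)

_⊆ᵇ_ : ∀ {N} → Subset N → Subset N → Bool
[]       ⊆ᵇ []       = true
(x ∷ xs) ⊆ᵇ (y ∷ ys) = (not x ∨ y) ∧ (xs ⊆ᵇ ys)

_==ᵇ_ : ∀ {N} → Subset N → Subset N → Bool
σ ==ᵇ τ = (σ ⊆ᵇ τ) ∧ (τ ⊆ᵇ σ)

-- vertex maps Fin N → Fin N, stored as lookup tables (so ≡ is extensional)
VMap : ℕ → Set
VMap N = Vec (Fin N) N

idMap : ∀ {N} → VMap N
idMap = tabulate (λ v → v)

_∘ᵐ_ : ∀ {N} → VMap N → VMap N → VMap N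
g ∘ᵐ h = tabulate (λ v → lookup g (lookup h v))

img : ∀ {N} → VMap N → Subset N → Subset N
img {N} g σ = tabulate (λ v → any (λ u → lookup σ u ∧ ⌊ lookup g u ≟ᶠ v ⌋) (allFin N))
  where
  open import Data.Fin using () renaming (_≟_ to _≟ᶠ_)
  open import Relation.Nullary.Decidable using (⌊_⌋)

-- (co)chains with F₂ coefficients: an F₂-valued function on simplices
-- (only its values on the simplices of the relevant dimension matter)
Chain : ℕ → Set
Chain N = Subset N → Bool

-- A finite pure n-dimensional complex X on vertex set Fin N, given by the
-- list of its n-faces (facets).  Faces are indexed by their SIZE m = k+1,
-- so size 0 is the empty simplex (dimension -1).

PureComplex : ∀ {N} → ℕ → List (Subset N) → Set
PureComplex n facets = (facets ≢ []) × All (λ σ → ∣ σ ∣ ≡ suc n) facets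

module Cx {N : ℕ} (n : ℕ) (facets : List (Subset N)) where

  isFace : Subset N → Bool
  isFace σ = any (σ ⊆ᵇ_) facets

  allFaces : List (Subset N)
  allFaces = filterᵇ isFace (allSubsets N)

  -- X(m-1): faces of size m
  X : ℕ → List (Subset N)
  X m = filterᵇ (λ σ → isFace σ ∧ (∣ σ ∣ ≡ᵇ m)) (allSubsets N)

  fₙ : ℕ
  fₙ = length (X (suc n))

  c : Subset N → ℕ
  c σ = length (filterᵇ (σ ⊆ᵇ_) (X (suc n)))

  w : Subset N → ℚ
  w σ = ℕ→ℚ (c σ) ÷₀ ℕ→ℚ ((suc n C ∣ σ ∣) ℕ.* fₙ)

  norm : ℕ → Chain N → ℚ
  norm m φ = sumℚ (map w (filterᵇ φ (X m)))

  _⊕_ : Chain N → Chain N → Chain N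
  (φ ⊕ ψ) σ = φ σ xor ψ σ

  δ : ℕ → Chain N → Chain N
  δ m φ η = parity (map (λ σ → φ σ ∧ (σ ⊆ᵇ η)) (X m))

  ∂ : ℕ → Chain N → Chain N
  ∂ m b ρ = parity (map (λ σ → b σ ∧ (ρ ⊆ᵇ σ)) (X (suc m)))

  indic : List (Subset N) → Chain N
  indic L σ = any (σ ==ᵇ_) L

  -- φ ∈ B^k(X), φ on faces of size k+1 (augmented complex: C^{-1} = F₂)
  IsCoboundary : ℕ → Chain N → Set
  IsCoboundary k φ = ∃[ ψ ] (∀ σ → σ ∈ X (suc k) → φ σ ≡ δ k ψ σ)

  classNorm : ℕ → Chain N → ℚ
  classNorm k φ = minℚ (map (λ L → norm (suc k) (φ ⊕ δ k (indic L))) (sublists (X k)))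

  -- "h_k(X) ≥ 1/θ", written without dividing:  for every φ ∈ C^k ∖ B^k,
  -- ‖[φ]‖ ≤ θ ‖d_k φ‖   (i.e. ‖d_k φ‖ / ‖[φ]‖ ≥ 1/θ)
  hₖ≥1/ : ℕ → ℚ → Set
  hₖ≥1/ k θ = ∀ φ → ¬ IsCoboundary k φ → classNorm k φ ≤ θ * norm (suc (suc k)) (δ (suc k) φ)

  -- τ ∈ X(k) with -1 ≤ k ≤ n-1, i.e. (s,τ) ∈ F_k
  InF : Subset N → Set
  InF τ = (τ ∈ allFaces) × (∣ τ ∣ ℕ.≤ n)

  SupportedIn : (Subset N → Bool) → ℕ → Chain N → Set
  SupportedIn P m z = ∀ σ → z σ ≡ true → (P σ ≡ true) × (σ ∈ X m)

  -- z (size-m chain) is a cycle of the augmented chain complex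
  IsCycle : ℕ → Chain N → Set
  IsCycle zero    z = Data.Unit.⊤ where import Data.Unit
  IsCycle (suc m) z = ∀ ρ → ρ ∈ X m → ∂ m z ρ ≡ false

  codim1 : Subset N → Subset N → Bool
  codim1 τ' τ = (τ' ⊆ᵇ τ) ∧ (suc ∣ τ' ∣ ≡ᵇ ∣ τ ∣)

  record BuildingLike : Set₁ where
    field
      G      : List (VMap N)
      G-id   : idMap ∈ G
      G-comp : ∀ {g h} → g ∈ G → h ∈ G → (g ∘ᵐ h) ∈ G
      G-inv  : ∀ {g} → g ∈ G → ∃[ h ] (h ∈ G × (g ∘ᵐ h) ≡ idMap × (h ∘ᵐ g) ≡ idMap)
      G-aut  : ∀ {g} → g ∈ G → ∀ σ → σ ∈ allFaces → img g σ ∈ allFaces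
      G-trans : ∀ σ σ' → σ ∈ X (suc n) → σ' ∈ X (suc n) → ∃[ g ] (g ∈ G × img g σ ≡ σ')
      M        : ℕ
      M-pos    : 0 ℕ.< M
      act      : VMap N → Fin M → Fin M
      act-id   : ∀ s → act idMap s ≡ s
      act-comp : ∀ {g h} → g ∈ G → h ∈ G → ∀ s → act (g ∘ᵐ h) s ≡ act g (act h s)
      B          : Fin M → Subset N → Subset N → Bool
      B-sub      : ∀ s τ → InF τ → ∀ σ → B s τ σ ≡ true → σ ∈ allFaces
      B-closed   : ∀ s τ → InF τ → ∀ σ ρ → B s τ σ ≡ true → (ρ ⊆ᵇ σ) ≡ true → B s τ ρ ≡ true
      B-contains : ∀ s τ → InF τ → B s τ τ ≡ true
      B-mono     : ∀ s τ τ' → InF τ → InF τ' → (τ ⊆ᵇ τ') ≡ true →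
                   ∀ σ → B s τ σ ≡ true → B s τ' σ ≡ true
      B-equiv    : ∀ {g} → g ∈ G → ∀ s τ → InF τ →
                   ∀ σ → B (act g s) (img g τ) (img g σ) ≡ B s τ σ
      -- H̃_i(B_{s,τ}; F₂) = 0 for -1 ≤ i ≤ k, where τ ∈ X(k); i-chains have size i+1 = m
      B-acyclic  : ∀ s τ → InF τ → ∀ m → m ℕ.≤ ∣ τ ∣ →
                   ∀ z → SupportedIn (B s τ) m z → IsCycle m z →
                   ∃[ b ] (SupportedIn (B s τ) (suc m) b × (∀ ρ → ρ ∈ X m → ∂ m b ρ ≡ z ρ))

  module _ (BL : BuildingLike) where
    open BuildingLike BL

    record ChainFamily : Set where
      field
        ch      : Fin M → Subset N → Chain N
        ch-supp : ∀ s τ → InF τ → SupportedIn (B s τ) (suc ∣ τ ∣) (ch s τ)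
        ch-bd   : ∀ s τ → InF τ → ∀ ρ → ρ ∈ X ∣ τ ∣ →
                  ∂ ∣ τ ∣ (ch s τ) ρ ≡
                    ((ρ ==ᵇ τ) xor parity (map (λ τ' → codim1 τ' τ ∧ ch s τ' ρ) allFaces))

    module _ (𝓒 : ChainFamily) where
      open ChainFamily 𝓒

      lam : ℕ → Subset N → ℚ
      lam k η =
        sumℚ (concatMap (λ s → map (λ τ → if ch s τ η then w τ else 0ℚ) (X (suc k))) (allFin M))
        ÷₀ (ℕ→ℚ M * w η)

      θ : ℕ → ℚ
      θ k = maxℚ (map (lam k) (X (suc (suc k))))

-- For each s ∈ S the chains c_{s,τ} give a cone contraction: with ψ_s(τ) = ⟨φ, c_{s,τ}⟩, pairing
-- dφ with c_{s,σ} and using ∂c_{s,σ} = σ + Σᵢ c_{s,σᵢ} yields (φ + dψ_s)(σ) = ⟨dφ, c_{s,σ}⟩.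
-- Hence ‖[φ]‖ ≤ ‖φ + dψ_s‖ is at most the total weight w(σ) of the pairs (σ, η) with
-- η ∈ supp dφ ∩ supp c_{s,σ}. Averaging over s and regrouping by η bounds this by
-- Σ_{η ∈ supp dφ} |S| w(η) λ(η) ≤ |S| θ_k ‖dφ‖.

module Submission where

open import Defs
open import Data.Nat using (ℕ; _<_)
open import Data.List using (List)
open import Data.Fin.Subset using (Subset)

open import Level using (Level)
open import Algebra.Bundles using (Semiring; CommutativeRing)
open import Data.Bool using (Bool; true; false; not; _∧_; _xor_; if_then_else_; T)
open import Data.Bool.Properties using (xor-∧-commutativeRing; ⇔→≡; if-∧; xor-identityʳ; ∧-assoc; ∧-comm; ∧-identityʳ; ∧-zeroʳ; ∧-distribˡ-xor; T-≡; T-∧)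
open import Algebra.Properties.CommutativeSemigroup (CommutativeRing.*-commutativeSemigroup xor-∧-commutativeRing) using (x∙yz≈y∙xz)
open import Data.Bool.Solver using (module xor-∧-Solver)
open import Data.Nat as ℕ using (zero; suc; _≡ᵇ_)
import Data.Nat.Properties as ℕP
open import Data.Nat.Combinatorics using (_C_; nCk+nC[k+1]≡[n+1]C[k+1])
open import Data.Integer as ℤ using (+_)
import Data.Integer.Properties as ℤP
import Data.Rational.Unnormalised as ℚᵘ
import Data.Rational.Unnormalised.Properties as ℚᵘP
open import Data.Fin using (Fin; fromℕ<)
open import Data.Fin.Subset using (∣_∣)
open import Data.Vec using ([]; _∷_)
open import Data.List using ([]; _∷_; map; _++_; foldr; length; allFin; concatMap; filterᵇ)
open import Data.List.Properties using (map-++; map-∘; map-cong; map-cong-local; foldr-preservesᵒ; length-tabulate)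
open import Data.List.Membership.Propositional using (_∈_; find)
open import Data.List.Membership.Propositional.Properties using (∈-filter⁺; ∈-filter⁻; ∈-map⁺; ∈-++⁺ˡ; ∈-++⁺ʳ; ∈-length; ∈-allFin)
open import Data.List.Relation.Unary.All as All using (All)
open import Data.List.Relation.Unary.Any as Any using (Any; here; there)
open import Data.List.Relation.Unary.Any.Properties using (any⁺; any⁻)
open import Data.Product using (_×_; _,_; ∃; proj₁; proj₂)
open import Data.Sum using (_⊎_; inj₁; inj₂)
open import Function using (_∘_; Equivalence; mk⇔)
open import Relation.Binary.PropositionalEquality using (_≡_; _≢_; refl; sym; trans; cong; cong₂; subst; ≢-sym; module ≡-Reasoning)
open import Relation.Nullary using (yes; no; contradiction)
open import Relation.Nullary.Decidable using (T?)

private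
  variable
    a b : Level
    A : Set a
    B : Set b

module ListSum {c ℓ} (R : Semiring c ℓ) where
  open Semiring R renaming (refl to ≈-refl; sym to ≈-sym; trans to ≈-trans)
  open import Algebra.Properties.CommutativeSemigroup +-commutativeSemigroup using (interchange)
  open import Relation.Binary.Reasoning.Setoid setoid

  sum : List Carrier → Carrier
  sum = foldr _+_ 0#

  sum-++ : ∀ xs ys → sum (xs ++ ys) ≈ sum xs + sum ys
  sum-++ []       ys = ≈-sym (+-identityˡ _)
  sum-++ (x ∷ xs) ys = ≈-trans (+-congˡ (sum-++ xs ys)) (≈-sym (+-assoc x _ _))

  sum-zero : (xs : List A) → sum (map (λ _ → 0#) xs) ≈ 0#
  sum-zero []       = ≈-refl
  sum-zero (_ ∷ xs) = ≈-trans (+-identityˡ _) (sum-zero xs)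

  sum-distrib-+ : ∀ (f g : A → Carrier) xs →
    sum (map (λ x → f x + g x) xs) ≈ sum (map f xs) + sum (map g xs)
  sum-distrib-+ f g []       = ≈-sym (+-identityˡ 0#)
  sum-distrib-+ f g (x ∷ xs) =
    ≈-trans (+-congˡ (sum-distrib-+ f g xs)) (interchange (f x) (g x) _ _)

  sum-comm : ∀ (f : A → B → Carrier) xs ys →
    sum (map (λ x → sum (map (f x) ys)) xs) ≈ sum (map (λ y → sum (map (λ x → f x y) xs)) ys)
  sum-comm f []       ys = ≈-sym (sum-zero ys)
  sum-comm f (x ∷ xs) ys = begin
    sum (map (f x) ys) + sum (map (λ x → sum (map (f x) ys)) xs)
      ≈⟨ +-congˡ (sum-comm f xs ys) ⟩
    sum (map (f x) ys) + sum (map (λ y → sum (map (λ x → f x y) xs)) ys)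
      ≈⟨ sum-distrib-+ (f x) (λ y → sum (map (λ x → f x y) xs)) ys ⟨
    sum (map (λ y → sum (map (λ x → f x y) (x ∷ xs))) ys) ∎

  *-distribˡ-sum : ∀ x (f : A → Carrier) ys → x * sum (map f ys) ≈ sum (map (λ y → x * f y) ys)
  *-distribˡ-sum x f []       = zeroʳ x
  *-distribˡ-sum x f (y ∷ ys) = ≈-trans (distribˡ x (f y) _) (+-congˡ (*-distribˡ-sum x f ys))

  sum-if : ∀ c (f : A → Carrier) xs →
    sum (map (λ x → if c then f x else 0#) xs) ≈ (if c then sum (map f xs) else 0#)
  sum-if true  f xs = ≈-refl
  sum-if false f xs = sum-zero xs

  sum-filterᵇ : ∀ (p : A → Bool) (f : A → Carrier) xs →
    sum (map f (filterᵇ p xs)) ≈ sum (map (λ x → if p x then f x else 0#) xs)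
  sum-filterᵇ p f []       = ≈-refl
  sum-filterᵇ p f (x ∷ xs) with p x
  ... | true  = +-congˡ (sum-filterᵇ p f xs)
  ... | false = ≈-trans (sum-filterᵇ p f xs) (≈-sym (+-identityˡ _))

  sum-concatMap : ∀ (f : A → List Carrier) xs → sum (concatMap f xs) ≈ sum (map (sum ∘ f) xs)
  sum-concatMap f []       = ≈-refl
  sum-concatMap f (x ∷ xs) = ≈-trans (sum-++ (f x) (concatMap f xs)) (+-congˡ (sum-concatMap f xs))

open import Data.Rational as ℚ using (ℚ; 0ℚ; 1ℚ; _+_; _*_; _≤_; _⊓_; _⊔_)
import Data.Rational.Properties as ℚP

module F₂ = ListSum (CommutativeRing.semiring xor-∧-commutativeRing)
module Σℚ = ListSum (CommutativeRing.semiring ℚP.+-*-commutativeRing)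

parity-filterᵇ : ∀ (p f : A → Bool) xs → parity (map f (filterᵇ p xs)) ≡ parity (map (λ x → p x ∧ f x) xs)
parity-filterᵇ p f xs = trans (F₂.sum-filterᵇ p f xs) (cong parity (map-cong (λ x → if-false (p x)) xs))
  where
  if-false : ∀ b {x} → (if b then x else false) ≡ b ∧ x
  if-false true  = refl
  if-false false = refl

nCk>0 : ∀ {n k} → k ℕ.≤ n → 0 < n C k
nCk>0 {k = zero}          _           = ℕ.z<s
nCk>0 {suc n} {suc k} (ℕ.s≤s k≤n) =
  subst (0 <_) (nCk+nC[k+1]≡[n+1]C[k+1] n k) (ℕP.<-≤-trans (nCk>0 k≤n) (ℕP.m≤m+n _ _))

ℕ→ℚ-suc : ∀ m → ℕ→ℚ (suc m) ≡ 1ℚ + ℕ→ℚ m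
ℕ→ℚ-suc m = ℚP.toℚᵘ-injective (begin
  ℚ.toℚᵘ (ℕ→ℚ (suc m))             ≈⟨ ℚP.toℚᵘ-fromℚᵘ (ℚᵘ.mkℚᵘ (+ suc m) 0) ⟩
  ℚᵘ.mkℚᵘ (+ suc m) 0              ≈⟨ ℚᵘ.*≡* (cong (λ i → (+ 1 ℤ.+ i) ℤ.* + 1) (ℤP.*-identityʳ (+ m))) ⟨
  ℚᵘ.1ℚᵘ ℚᵘ.+ ℚᵘ.mkℚᵘ (+ m) 0       ≈⟨ ℚᵘP.+-congʳ ℚᵘ.1ℚᵘ (ℚP.toℚᵘ-fromℚᵘ (ℚᵘ.mkℚᵘ (+ m) 0)) ⟨
  ℚᵘ.1ℚᵘ ℚᵘ.+ ℚ.toℚᵘ (ℕ→ℚ m)        ≈⟨ ℚP.toℚᵘ-homo-+ 1ℚ (ℕ→ℚ m) ⟨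
  ℚ.toℚᵘ (1ℚ + ℕ→ℚ m)              ∎)
  where open ℚᵘP.≃-Reasoning

ℕ→ℚ-pos : ∀ {m} → 0 < m → 0ℚ ℚ.< ℕ→ℚ m
ℕ→ℚ-pos {suc m} _ = ℚP.positive⁻¹ (ℕ→ℚ (suc m)) {{ℚP.normalize-pos (suc m) 1}}

÷₀-*-cancel : ∀ p {q} → q ≢ 0ℚ → (p ÷₀ q) * q ≡ p
÷₀-*-cancel p {q} q≢0 with q ℚP.≟ 0ℚ
... | yes q≡0 = contradiction q≡0 q≢0
... | no  _   = begin
  p * ℚ.1/ q * q     ≡⟨ ℚP.*-assoc p (ℚ.1/ q) q ⟩
  p * (ℚ.1/ q * q)   ≡⟨ cong (p *_) (ℚP.*-inverseˡ q) ⟩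
  p * 1ℚ             ≡⟨ ℚP.*-identityʳ p ⟩
  p                  ∎
  where
  open ≡-Reasoning
  instance _ = ℚ.≢-nonZero q≢0

÷₀-pos : ∀ {p q} → 0ℚ ℚ.< p → 0ℚ ℚ.< q → 0ℚ ℚ.< p ÷₀ q
÷₀-pos {p} {q} 0<p 0<q = ℚP.*-cancelʳ-<-nonNeg q {{ℚ.nonNegative (ℚP.<⇒≤ 0<q)}} (begin-strict
  0ℚ * q          ≡⟨ ℚP.*-zeroˡ q ⟩
  0ℚ              <⟨ 0<p ⟩
  p               ≡⟨ ÷₀-*-cancel p (≢-sym (ℚP.<⇒≢ 0<q)) ⟨
  (p ÷₀ q) * q    ∎)
  where open ℚP.≤-Reasoning

minℚ-≤ : ∀ {x xs} → x ∈ xs → minℚ xs ≤ x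
minℚ-≤ {x} {y ∷ ys} x∈ = foldr-preservesᵒ ⊓-≤ y ys (split x∈)
  where
  ⊓-≤ : ∀ p q → p ≤ x ⊎ q ≤ x → p ⊓ q ≤ x
  ⊓-≤ p q (inj₁ p≤x) = ℚP.p≤q⇒p⊓r≤q q p≤x
  ⊓-≤ p q (inj₂ q≤x) = ℚP.p≤q⇒r⊓p≤q p q≤x
  split : ∀ {y ys} → x ∈ y ∷ ys → y ≤ x ⊎ Any (_≤ x) ys
  split (here refl) = inj₁ ℚP.≤-refl
  split (there x∈)  = inj₂ (Any.map (λ { refl → ℚP.≤-refl }) x∈)

≤-maxℚ : ∀ {x xs} → x ∈ xs → x ≤ maxℚ xs
≤-maxℚ {x} {y ∷ ys} x∈ = foldr-preservesᵒ ≤-⊔ y ys (split x∈)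
  where
  ≤-⊔ : ∀ p q → x ≤ p ⊎ x ≤ q → x ≤ p ⊔ q
  ≤-⊔ p q (inj₁ x≤p) = ℚP.p≤q⇒p≤q⊔r q x≤p
  ≤-⊔ p q (inj₂ x≤q) = ℚP.p≤q⇒p≤r⊔q p x≤q
  split : ∀ {y ys} → x ∈ y ∷ ys → x ≤ y ⊎ Any (x ≤_) ys
  split (here refl) = inj₁ ℚP.≤-refl
  split (there x∈)  = inj₂ (Any.map (λ { refl → ℚP.≤-refl }) x∈)

sumℚ-const : ∀ q (xs : List A) → sumℚ (map (λ _ → q) xs) ≡ ℕ→ℚ (length xs) * q
sumℚ-const q []       = sym (ℚP.*-zeroˡ q)
sumℚ-const q (_ ∷ xs) = begin
  q + sumℚ (map (λ _ → q) xs)      ≡⟨ cong₂ _+_ (sym (ℚP.*-identityˡ q)) (sumℚ-const q xs) ⟩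
  1ℚ * q + ℕ→ℚ (length xs) * q     ≡⟨ ℚP.*-distribʳ-+ q 1ℚ (ℕ→ℚ (length xs)) ⟨
  (1ℚ + ℕ→ℚ (length xs)) * q       ≡⟨ cong (_* q) (ℕ→ℚ-suc (length xs)) ⟨
  ℕ→ℚ (suc (length xs)) * q        ∎
  where open ≡-Reasoning

sumℚ-mono-≤ : ∀ {f g : A → ℚ} xs → (∀ {x} → x ∈ xs → f x ≤ g x) → sumℚ (map f xs) ≤ sumℚ (map g xs)
sumℚ-mono-≤ []       f≤g = ℚP.≤-refl
sumℚ-mono-≤ (x ∷ xs) f≤g = ℚP.+-mono-≤ (f≤g (here refl)) (sumℚ-mono-≤ xs (f≤g ∘ there))

if-≤-* : ∀ b {x y c} → x ≤ c * y → (if b then x else 0ℚ) ≤ c * (if b then y else 0ℚ)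
if-≤-* true  x≤cy = x≤cy
if-≤-* false {c = c} _ = ℚP.≤-reflexive (sym (ℚP.*-zeroʳ c))

≤-mean : ∀ {x y} (f : A → ℚ) xs → 0 < length xs → (∀ {s} → s ∈ xs → x ≤ f s) →
         sumℚ (map f xs) ≤ ℕ→ℚ (length xs) * y → x ≤ y
≤-mean {x = x} {y} f xs 0<len x≤f Σf≤ = ℚP.*-cancelˡ-≤-pos (ℕ→ℚ (length xs)) {{ℚ.positive (ℕ→ℚ-pos 0<len)}} (begin
  ℕ→ℚ (length xs) * x        ≡⟨ sumℚ-const x xs ⟨
  sumℚ (map (λ _ → x) xs)    ≤⟨ sumℚ-mono-≤ xs x≤f ⟩
  sumℚ (map f xs)            ≤⟨ Σf≤ ⟩
  ℕ→ℚ (length xs) * y        ∎)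
  where open ℚP.≤-Reasoning

if-parity≤sum-if : ∀ {q} → 0ℚ ≤ q → (p : A → Bool) (xs : List A) →
  (if parity (map p xs) then q else 0ℚ) ≤ sumℚ (map (λ x → if p x then q else 0ℚ) xs)
if-parity≤sum-if 0≤q p []       = ℚP.≤-refl
if-parity≤sum-if {q = q} 0≤q p (x ∷ xs) with p x | if-parity≤sum-if 0≤q p xs
... | false | ih = ℚP.≤-trans ih (ℚP.≤-reflexive (sym (ℚP.+-identityˡ _)))
... | true  | ih = begin
  (if not rest then q else 0ℚ)   ≤⟨ if≤ (not rest) ⟩
  q                           ≡⟨ ℚP.+-identityʳ q ⟨
  q + 0ℚ                      ≤⟨ ℚP.+-monoʳ-≤ q (ℚP.≤-trans (0≤if rest) ih) ⟩
  q + sumℚ (map (λ x → if p x then q else 0ℚ) xs) ∎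
  where
  open ℚP.≤-Reasoning
  rest : Bool
  rest = parity (map p xs)
  if≤ : ∀ c → (if c then q else 0ℚ) ≤ q
  if≤ true  = ℚP.≤-refl
  if≤ false = 0≤q
  0≤if : ∀ c → 0ℚ ≤ (if c then q else 0ℚ)
  0≤if true  = 0≤q
  0≤if false = ℚP.≤-refl

∈-allSubsets : ∀ {N} (σ : Subset N) → σ ∈ allSubsets N
∈-allSubsets []          = here refl
∈-allSubsets (false ∷ σ) = ∈-++⁺ˡ (∈-map⁺ (false ∷_) (∈-allSubsets σ))
∈-allSubsets {suc N} (true ∷ σ) = ∈-++⁺ʳ (map (false ∷_) (allSubsets N)) (∈-map⁺ (true ∷_) (∈-allSubsets σ))

⊆ᵇ-refl : ∀ {N} (σ : Subset N) → T (σ ⊆ᵇ σ)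
⊆ᵇ-refl []          = _
⊆ᵇ-refl (false ∷ σ) = ⊆ᵇ-refl σ
⊆ᵇ-refl (true ∷ σ)  = ⊆ᵇ-refl σ

==ᵇ-refl : ∀ {N} (σ : Subset N) → T (σ ==ᵇ σ)
==ᵇ-refl σ = Equivalence.from T-∧ (⊆ᵇ-refl σ , ⊆ᵇ-refl σ)

⊆ᵇ-antisym : ∀ {N} {σ τ : Subset N} → T (σ ⊆ᵇ τ) → T (τ ⊆ᵇ σ) → σ ≡ τ
⊆ᵇ-antisym {σ = []}        {[]}        _   _   = refl
⊆ᵇ-antisym {σ = false ∷ σ} {false ∷ τ} σ⊆τ τ⊆σ = cong (false ∷_) (⊆ᵇ-antisym σ⊆τ τ⊆σ)
⊆ᵇ-antisym {σ = true ∷ σ}  {true ∷ τ}  σ⊆τ τ⊆σ = cong (true ∷_) (⊆ᵇ-antisym σ⊆τ τ⊆σ)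

==ᵇ⇒≡ : ∀ {N} {σ τ : Subset N} → T (σ ==ᵇ τ) → σ ≡ τ
==ᵇ⇒≡ σ==τ = let σ⊆τ , τ⊆σ = Equivalence.to T-∧ σ==τ in ⊆ᵇ-antisym σ⊆τ τ⊆σ

parity-allSubsets-suc : ∀ {N} (g : Subset (suc N) → Bool) →
  parity (map g (allSubsets (suc N))) ≡
    parity (map (g ∘ (false ∷_)) (allSubsets N)) xor parity (map (g ∘ (true ∷_)) (allSubsets N))
parity-allSubsets-suc {N} g = begin
  parity (map g (map (false ∷_) S ++ map (true ∷_) S))
    ≡⟨ cong parity (map-++ g (map (false ∷_) S) (map (true ∷_) S)) ⟩
  parity (map g (map (false ∷_) S) ++ map g (map (true ∷_) S))
    ≡⟨ F₂.sum-++ (map g (map (false ∷_) S)) (map g (map (true ∷_) S)) ⟩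
  parity (map g (map (false ∷_) S)) xor parity (map g (map (true ∷_) S))
    ≡⟨ cong₂ (λ u v → parity u xor parity v) (map-∘ S) (map-∘ S) ⟨
  parity (map (g ∘ (false ∷_)) S) xor parity (map (g ∘ (true ∷_)) S) ∎
  where
  open ≡-Reasoning
  S : List (Subset N)
  S = allSubsets N

parity-kronecker : ∀ {N} (f : Subset N → Bool) σ →
  parity (map (λ ρ → f ρ ∧ (ρ ==ᵇ σ)) (allSubsets N)) ≡ f σ
parity-kronecker f [] = trans (xor-identityʳ _) (∧-identityʳ (f []))
-- Split by the first coordinate: only the half starting with x can meet σ.
parity-kronecker {suc N} f (x ∷ σ) =
  trans (parity-allSubsets-suc g) (halves x match mismatch)
  where
  g : Subset (suc N) → Bool
  g ρ = f ρ ∧ (ρ ==ᵇ (x ∷ σ))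
  ==ᵇ-∷ : ∀ y (ρ : Subset N) → ((y ∷ ρ) ==ᵇ (y ∷ σ)) ≡ (ρ ==ᵇ σ)
  ==ᵇ-∷ false ρ = refl
  ==ᵇ-∷ true  ρ = refl
  ==ᵇ-∷-not : ∀ y (ρ : Subset N) → ((not y ∷ ρ) ==ᵇ (y ∷ σ)) ≡ false
  ==ᵇ-∷-not false ρ = refl
  ==ᵇ-∷-not true  ρ = ∧-zeroʳ (ρ ⊆ᵇ σ)
  match : parity (map (g ∘ (x ∷_)) (allSubsets N)) ≡ f (x ∷ σ)
  match = trans (cong parity (map-cong (λ ρ → cong (f (x ∷ ρ) ∧_) (==ᵇ-∷ x ρ)) (allSubsets N)))
                (parity-kronecker (f ∘ (x ∷_)) σ)
  mismatch : parity (map (g ∘ (not x ∷_)) (allSubsets N)) ≡ false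
  mismatch = trans (cong parity (map-cong (λ ρ → trans (cong (f (not x ∷ ρ) ∧_) (==ᵇ-∷-not x ρ)) (∧-zeroʳ _)) (allSubsets N)))
                   (F₂.sum-zero (allSubsets N))
  halves : ∀ y → parity (map (g ∘ (y ∷_)) (allSubsets N)) ≡ f (x ∷ σ) →
           parity (map (g ∘ (not y ∷_)) (allSubsets N)) ≡ false →
           parity (map (g ∘ (false ∷_)) (allSubsets N)) xor parity (map (g ∘ (true ∷_)) (allSubsets N)) ≡ f (x ∷ σ)
  halves false on off = trans (cong₂ _xor_ on off) (xor-identityʳ _)
  halves true  on off = cong₂ _xor_ off on

filterᵇ∈sublists : ∀ (p : A → Bool) xs → filterᵇ p xs ∈ sublists xs
filterᵇ∈sublists p []       = here refl
filterᵇ∈sublists p (x ∷ xs) with p x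
... | true  = ∈-++⁺ʳ (sublists xs) (∈-map⁺ (x ∷_) (filterᵇ∈sublists p xs))
... | false = ∈-++⁺ˡ (filterᵇ∈sublists p xs)

module Complex {N : ℕ} (n : ℕ) (facets : List (Subset N)) where
  open Cx n facets

  Xᵇ : ℕ → Subset N → Bool
  Xᵇ m σ = isFace σ ∧ (∣ σ ∣ ≡ᵇ m)

  X⁺ : ∀ {m σ} → T (isFace σ) → ∣ σ ∣ ≡ m → σ ∈ X m
  X⁺ {m} {σ} face size =
    ∈-filter⁺ (T? ∘ Xᵇ m) (∈-allSubsets σ) (Equivalence.from T-∧ (face , ℕP.≡⇒≡ᵇ ∣ σ ∣ m size))

  X⁻ : ∀ {m σ} → σ ∈ X m → T (isFace σ) × ∣ σ ∣ ≡ m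
  X⁻ {m} {σ} σ∈ = let face , size = Equivalence.to T-∧ (proj₂ (∈-filter⁻ (T? ∘ Xᵇ m) {xs = allSubsets N} σ∈))
                  in face , ℕP.≡ᵇ⇒≡ ∣ σ ∣ m size

  X⇒InF : ∀ {m σ} → σ ∈ X m → m ℕ.≤ n → InF σ
  X⇒InF {σ = σ} σ∈ m≤n = let face , size = X⁻ σ∈ in
    ∈-filter⁺ (T? ∘ isFace) (∈-allSubsets σ) face , subst (ℕ._≤ n) (sym size) m≤n

  norm-as-sum : ∀ m φ → norm m φ ≡ sumℚ (map (λ σ → if φ σ then w σ else 0ℚ) (X m))
  norm-as-sum m φ = Σℚ.sum-filterᵇ φ w (X m)

  indic-filterᵇ : ∀ (p : Subset N → Bool) {τ xs} → τ ∈ xs → indic (filterᵇ p xs) τ ≡ p τ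
  indic-filterᵇ p {τ} {xs} τ∈ =
    ⇔→≡ {z = true} (mk⇔ (Equivalence.to T-≡ ∘ hit⇒p ∘ Equivalence.from T-≡)
                        (Equivalence.to T-≡ ∘ p⇒hit ∘ Equivalence.from T-≡))
    where
    p⇒hit : T (p τ) → T (indic (filterᵇ p xs) τ)
    p⇒hit pτ = any⁺ (τ ==ᵇ_) (Any.map (λ { refl → ==ᵇ-refl τ }) (∈-filter⁺ (T? ∘ p) τ∈ pτ))
    hit⇒p : T (indic (filterᵇ p xs) τ) → T (p τ)
    hit⇒p hit = let x , x∈ , τ==x = find (any⁻ (τ ==ᵇ_) (filterᵇ p xs) hit)
                in subst (T ∘ p) (sym (==ᵇ⇒≡ τ==x)) (proj₂ (∈-filter⁻ (T? ∘ p) {xs = xs} x∈))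

  ⟨_,_⟩[_] : Chain N → Chain N → ℕ → Bool
  ⟨ φ , z ⟩[ m ] = parity (map (λ σ → φ σ ∧ z σ) (X m))

  pairing-congˡ : ∀ {m} {φ φ′ : Chain N} z → (∀ {σ} → σ ∈ X m → φ σ ≡ φ′ σ) → ⟨ φ , z ⟩[ m ] ≡ ⟨ φ′ , z ⟩[ m ]
  pairing-congˡ z φ≡φ′ = cong parity (map-cong-local (All.tabulate (λ σ∈ → cong (_∧ z _) (φ≡φ′ σ∈))))

  pairing-congʳ : ∀ {m} φ {z z′ : Chain N} → (∀ {σ} → σ ∈ X m → z σ ≡ z′ σ) → ⟨ φ , z ⟩[ m ] ≡ ⟨ φ , z′ ⟩[ m ]
  pairing-congʳ φ z≡z′ = cong parity (map-cong-local (All.tabulate (λ σ∈ → cong (φ _ ∧_) (z≡z′ σ∈))))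

  pairing-xorʳ : ∀ m φ (z z′ : Chain N) → ⟨ φ , z ⊕ z′ ⟩[ m ] ≡ ⟨ φ , z ⟩[ m ] xor ⟨ φ , z′ ⟩[ m ]
  pairing-xorʳ m φ z z′ = trans (cong parity (map-cong (λ σ → ∧-distribˡ-xor (φ σ) (z σ) (z′ σ)) (X m)))
                                (F₂.sum-distrib-+ (λ σ → φ σ ∧ z σ) (λ σ → φ σ ∧ z′ σ) (X m))

  pairing-sumʳ : ∀ m φ (coeff : A → Bool) (z : A → Chain N) js →
    ⟨ φ , (λ ρ → parity (map (λ j → coeff j ∧ z j ρ) js)) ⟩[ m ] ≡ parity (map (λ j → coeff j ∧ ⟨ φ , z j ⟩[ m ]) js)
  pairing-sumʳ m φ coeff z js = begin
    parity (map (λ σ → φ σ ∧ parity (map (λ j → coeff j ∧ z j σ) js)) (X m))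
      ≡⟨ cong parity (map-cong (λ σ → F₂.*-distribˡ-sum (φ σ) (λ j → coeff j ∧ z j σ) js) (X m)) ⟩
    parity (map (λ σ → parity (map (λ j → φ σ ∧ (coeff j ∧ z j σ)) js)) (X m))
      ≡⟨ F₂.sum-comm (λ σ j → φ σ ∧ (coeff j ∧ z j σ)) (X m) js ⟩
    parity (map (λ j → parity (map (λ σ → φ σ ∧ (coeff j ∧ z j σ)) (X m))) js)
      ≡⟨ cong parity (map-cong (λ j → cong parity (map-cong (λ σ → x∙yz≈y∙xz (φ σ) (coeff j) (z j σ)) (X m))) js) ⟩
    parity (map (λ j → parity (map (λ σ → coeff j ∧ (φ σ ∧ z j σ)) (X m))) js)
      ≡⟨ cong parity (map-cong (λ j → F₂.*-distribˡ-sum (coeff j) (λ σ → φ σ ∧ z j σ) (X m)) js) ⟨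
    parity (map (λ j → coeff j ∧ ⟨ φ , z j ⟩[ m ]) js) ∎
    where open ≡-Reasoning

  pairing-kronecker : ∀ {m σ} φ → σ ∈ X m → ⟨ φ , (_==ᵇ σ) ⟩[ m ] ≡ φ σ
  pairing-kronecker {m} {σ} φ σ∈ = begin
    parity (map (λ ρ → φ ρ ∧ (ρ ==ᵇ σ)) (X m))
      ≡⟨ parity-filterᵇ (Xᵇ m) (λ ρ → φ ρ ∧ (ρ ==ᵇ σ)) (allSubsets N) ⟩
    parity (map (λ ρ → Xᵇ m ρ ∧ (φ ρ ∧ (ρ ==ᵇ σ))) (allSubsets N))
      ≡⟨ cong parity (map-cong (λ ρ → ∧-assoc (Xᵇ m ρ) (φ ρ) (ρ ==ᵇ σ)) (allSubsets N)) ⟨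
    parity (map (λ ρ → (Xᵇ m ρ ∧ φ ρ) ∧ (ρ ==ᵇ σ)) (allSubsets N))
      ≡⟨ parity-kronecker (λ ρ → Xᵇ m ρ ∧ φ ρ) σ ⟩
    Xᵇ m σ ∧ φ σ
      ≡⟨ cong (_∧ φ σ) (Equivalence.to T-≡ (proj₂ (∈-filter⁻ (T? ∘ Xᵇ m) {xs = allSubsets N} σ∈))) ⟩
    φ σ ∎
    where open ≡-Reasoning

  -- δ m φ σ is literally ⟨ φ , (_⊆ᵇ σ) ⟩[ m ], and ∂ m b is a combination of these chains.
  δ-∂-adjoint : ∀ m φ b → ⟨ δ m φ , b ⟩[ suc m ] ≡ ⟨ φ , ∂ m b ⟩[ m ]
  δ-∂-adjoint m φ b = sym (trans (pairing-sumʳ m φ b (λ σ ρ → ρ ⊆ᵇ σ) (X (suc m)))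
                                 (cong parity (map-cong (λ σ → ∧-comm (b σ) (δ m φ σ)) (X (suc m)))))

  δ-codim1 : ∀ k ψ {σ} → ∣ σ ∣ ≡ suc k → δ k ψ σ ≡ parity (map (λ τ → codim1 τ σ ∧ ψ τ) allFaces)
  δ-codim1 k ψ {σ} size = begin
    parity (map (λ τ → ψ τ ∧ (τ ⊆ᵇ σ)) (X k))
      ≡⟨ parity-filterᵇ (Xᵇ k) (λ τ → ψ τ ∧ (τ ⊆ᵇ σ)) (allSubsets N) ⟩
    parity (map (λ τ → Xᵇ k τ ∧ (ψ τ ∧ (τ ⊆ᵇ σ))) (allSubsets N))
      ≡⟨ cong parity (map-cong rearrange (allSubsets N)) ⟩
    parity (map (λ τ → isFace τ ∧ (codim1 τ σ ∧ ψ τ)) (allSubsets N))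
      ≡⟨ parity-filterᵇ isFace (λ τ → codim1 τ σ ∧ ψ τ) (allSubsets N) ⟨
    parity (map (λ τ → codim1 τ σ ∧ ψ τ) allFaces) ∎
    where
    open ≡-Reasoning
    open xor-∧-Solver
    rearrange : ∀ τ → Xᵇ k τ ∧ (ψ τ ∧ (τ ⊆ᵇ σ)) ≡ isFace τ ∧ (codim1 τ σ ∧ ψ τ)
    rearrange τ = trans
      (solve 4 (λ f e g s → (f :* e) :* (g :* s) := f :* ((s :* e) :* g)) refl (isFace τ) (∣ τ ∣ ≡ᵇ k) (ψ τ) (τ ⊆ᵇ σ))
      (cong (λ j → isFace τ ∧ (((τ ⊆ᵇ σ) ∧ (suc ∣ τ ∣ ≡ᵇ j)) ∧ ψ τ)) (sym size))

  module _ (pure : PureComplex n facets) where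

    facet∈X : ∀ {F} → F ∈ facets → F ∈ X (suc n)
    facet∈X {F} F∈ = X⁺ (any⁺ (F ⊆ᵇ_) (Any.map (λ { refl → ⊆ᵇ-refl F }) F∈)) (All.lookup (proj₂ pure) F∈)

    fₙ>0 : 0 < fₙ
    fₙ>0 = ∈-length (facet∈X (proj₂ (some-facet facets (proj₁ pure))))
      where
      some-facet : (Fs : List (Subset N)) → Fs ≢ [] → ∃ (_∈ Fs)
      some-facet []      Fs≢[] = contradiction refl Fs≢[]
      some-facet (F ∷ _) _     = F , here refl

    c>0 : ∀ {m σ} → σ ∈ X m → 0 < c σ
    c>0 {σ = σ} σ∈ =
      let F , F∈ , σ⊆F = find (any⁻ (σ ⊆ᵇ_) facets (proj₁ (X⁻ σ∈)))
      in ∈-length (∈-filter⁺ (T? ∘ (σ ⊆ᵇ_)) (facet∈X F∈) σ⊆F)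

    w>0 : ∀ {m σ} → σ ∈ X m → m ℕ.≤ suc n → 0ℚ ℚ.< w σ
    w>0 {σ = σ} σ∈ m≤1+n = ÷₀-pos (ℕ→ℚ-pos (c>0 σ∈)) (ℕ→ℚ-pos (ℕ.>-nonZero⁻¹ _ {{nonZero}}))
      where
      nonZero : ℕ.NonZero ((suc n C ∣ σ ∣) ℕ.* fₙ)
      nonZero = ℕP.m*n≢0 _ _ {{ℕ.>-nonZero (nCk>0 (subst (ℕ._≤ suc n) (sym (proj₂ (X⁻ σ∈))) m≤1+n))}}
                             {{ℕ.>-nonZero fₙ>0}}

module Cone {N : ℕ} {n : ℕ} {facets : List (Subset N)}
            (BL : Cx.BuildingLike n facets) (𝓒 : Cx.ChainFamily n facets BL) where
  open Cx n facets
  open Complex n facets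
  open BuildingLike BL
  open ChainFamily 𝓒

  ∂-ch : ∀ s {σ m} → InF σ → ∣ σ ∣ ≡ m → ∀ {ρ} → ρ ∈ X m →
         ∂ m (ch s σ) ρ ≡ ((ρ ==ᵇ σ) xor parity (map (λ τ → codim1 τ σ ∧ ch s τ ρ) allFaces))
  ∂-ch s inF refl = ch-bd s _ inF _

  -- ψ_s of the proof sketch, for φ a cochain on faces of size suc k
  cone : Fin M → ℕ → Chain N → Chain N
  cone s k φ τ = ⟨ φ , ch s τ ⟩[ suc k ]

  cone-identity : ∀ s k φ {σ} → σ ∈ X (suc k) → k < n →
    (φ ⊕ δ k (cone s k φ)) σ ≡ ⟨ δ (suc k) φ , ch s σ ⟩[ suc (suc k) ]
  cone-identity s k φ {σ} σ∈ k<n = sym (begin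
    ⟨ δ (suc k) φ , ch s σ ⟩[ suc (suc k) ]
      ≡⟨ δ-∂-adjoint (suc k) φ (ch s σ) ⟩
    ⟨ φ , ∂ (suc k) (ch s σ) ⟩[ suc k ]
      ≡⟨ pairing-congʳ φ (∂-ch s (X⇒InF σ∈ k<n) (proj₂ (X⁻ σ∈))) ⟩
    ⟨ φ , (_==ᵇ σ) ⊕ faces ⟩[ suc k ]
      ≡⟨ pairing-xorʳ (suc k) φ (_==ᵇ σ) faces ⟩
    ⟨ φ , (_==ᵇ σ) ⟩[ suc k ] xor ⟨ φ , faces ⟩[ suc k ]
      ≡⟨ cong₂ _xor_ (pairing-kronecker φ σ∈) (pairing-sumʳ (suc k) φ (λ τ → codim1 τ σ) (ch s) allFaces) ⟩
    φ σ xor parity (map (λ τ → codim1 τ σ ∧ cone s k φ τ) allFaces)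
      ≡⟨ cong (φ σ xor_) (δ-codim1 k (cone s k φ) (proj₂ (X⁻ σ∈))) ⟨
    φ σ xor δ k (cone s k φ) σ ∎)
    where
    open ≡-Reasoning
    faces : Chain N
    faces ρ = parity (map (λ τ → codim1 τ σ ∧ ch s τ ρ) allFaces)

module Averaging {N : ℕ} {n : ℕ} {facets : List (Subset N)} (pure : PureComplex n facets)
                 (BL : Cx.BuildingLike n facets) (𝓒 : Cx.ChainFamily n facets BL)
                 {k : ℕ} (k<n : k < n) (φ : Chain N) where
  open Cx n facets
  open Complex n facets
  open Cone BL 𝓒
  open BuildingLike BL
  open ChainFamily 𝓒

  dφ : Chain N
  dφ = δ (suc k) φ

  term : Fin M → Subset N → Subset N → ℚ
  term s σ η = if dφ η ∧ ch s σ η then w σ else 0ℚ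

  bound : Fin M → ℚ
  bound s = sumℚ (map (λ σ → sumℚ (map (term s σ) (X (suc (suc k))))) (X (suc k)))

  classNorm≤bound : ∀ s → classNorm k φ ≤ bound s
  classNorm≤bound s = begin
    classNorm k φ
      ≤⟨ minℚ-≤ (∈-map⁺ (λ L → norm (suc k) (φ ⊕ δ k (indic L))) (filterᵇ∈sublists (cone s k φ) (X k))) ⟩
    norm (suc k) (φ ⊕ δ k (indic Ls))
      ≡⟨ norm-as-sum (suc k) (φ ⊕ δ k (indic Ls)) ⟩
    sumℚ (map (λ σ → if (φ ⊕ δ k (indic Ls)) σ then w σ else 0ℚ) (X (suc k)))
      ≡⟨ cong sumℚ (map-cong-local (All.tabulate (λ {σ} σ∈ → cong (λ b → if b then w σ else 0ℚ) (cone-value σ∈)))) ⟩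
    sumℚ (map (λ σ → if ⟨ dφ , ch s σ ⟩[ suc (suc k) ] then w σ else 0ℚ) (X (suc k)))
      ≤⟨ sumℚ-mono-≤ (X (suc k)) (λ σ∈ → if-parity≤sum-if (ℚP.<⇒≤ (w>0 pure σ∈ (ℕP.m≤n⇒m≤1+n k<n))) (λ η → dφ η ∧ ch s _ η) (X (suc (suc k)))) ⟩
    bound s ∎
    where
    open ℚP.≤-Reasoning
    Ls : List (Subset N)
    Ls = filterᵇ (cone s k φ) (X k)
    cone-value : ∀ {σ} → σ ∈ X (suc k) → (φ ⊕ δ k (indic Ls)) σ ≡ ⟨ dφ , ch s σ ⟩[ suc (suc k) ]
    cone-value {σ} σ∈ = trans (cong (φ σ xor_) (pairing-congˡ (_⊆ᵇ σ) (indic-filterᵇ (cone s k φ))))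
                              (cone-identity s k φ σ∈ k<n)

  θₖ : ℚ
  θₖ = θ BL 𝓒 k

  S : List (Fin M)
  S = allFin M

  coverWeight : Fin M → Subset N → ℚ
  coverWeight s η = sumℚ (map (λ σ → if ch s σ η then w σ else 0ℚ) (X (suc k)))

  -- λ(η) is defined with ÷₀, so the positivity of |S| w(η) is needed to multiply back.
  mass≤θ : ∀ {η} → η ∈ X (suc (suc k)) →
    sumℚ (map (λ s → coverWeight s η) S) ≤ (θₖ * ℕ→ℚ M) * w η
  mass≤θ {η} η∈ = begin
    sumℚ (map (λ s → coverWeight s η) S)
      ≡⟨ Σℚ.sum-concatMap (λ s → map (λ σ → if ch s σ η then w σ else 0ℚ) (X (suc k))) S ⟨
    sumℚ (concatMap (λ s → map (λ σ → if ch s σ η then w σ else 0ℚ) (X (suc k))) S)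
      ≡⟨ ÷₀-*-cancel _ (≢-sym (ℚP.<⇒≢ Mwη>0)) ⟨
    lam BL 𝓒 k η * (ℕ→ℚ M * w η)
      ≤⟨ ℚP.*-monoʳ-≤-nonNeg (ℕ→ℚ M * w η) {{ℚ.nonNegative (ℚP.<⇒≤ Mwη>0)}} (≤-maxℚ (∈-map⁺ (lam BL 𝓒 k) η∈)) ⟩
    θₖ * (ℕ→ℚ M * w η)
      ≡⟨ ℚP.*-assoc θₖ (ℕ→ℚ M) (w η) ⟨
    (θₖ * ℕ→ℚ M) * w η ∎
    where
    open ℚP.≤-Reasoning
    Mwη>0 : 0ℚ ℚ.< ℕ→ℚ M * w η
    Mwη>0 = ℚP.positive⁻¹ _ {{ℚP.pos*pos⇒pos (ℕ→ℚ M) {{ℚ.positive (ℕ→ℚ-pos M-pos)}}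
                                            (w η) {{ℚ.positive (w>0 pure η∈ (ℕ.s≤s k<n))}}}}

  column≤ : ∀ {η} → η ∈ X (suc (suc k)) →
    sumℚ (map (λ s → sumℚ (map (λ σ → term s σ η) (X (suc k)))) S) ≤ (θₖ * ℕ→ℚ M) * (if dφ η then w η else 0ℚ)
  column≤ {η} η∈ = begin
    sumℚ (map (λ s → sumℚ (map (λ σ → term s σ η) (X (suc k)))) S)
      ≡⟨ cong sumℚ (map-cong (λ s → trans (cong sumℚ (map-cong (λ σ → if-∧ (dφ η)) (X (suc k))))
                                          (Σℚ.sum-if (dφ η) (λ σ → if ch s σ η then w σ else 0ℚ) (X (suc k)))) S) ⟩
    sumℚ (map (λ s → if dφ η then coverWeight s η else 0ℚ) S)
      ≡⟨ Σℚ.sum-if (dφ η) (λ s → coverWeight s η) S ⟩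
    (if dφ η then sumℚ (map (λ s → coverWeight s η) S) else 0ℚ)
      ≤⟨ if-≤-* (dφ η) {c = θₖ * ℕ→ℚ M} (mass≤θ η∈) ⟩
    (θₖ * ℕ→ℚ M) * (if dφ η then w η else 0ℚ) ∎
    where open ℚP.≤-Reasoning

  sum-bound≤ : sumℚ (map bound S) ≤ ℕ→ℚ (length S) * (θₖ * norm (suc (suc k)) dφ)
  sum-bound≤ = begin
    sumℚ (map bound S)
      ≡⟨ cong sumℚ (map-cong (λ s → Σℚ.sum-comm (term s) (X (suc k)) (X (suc (suc k)))) S) ⟩
    sumℚ (map (λ s → sumℚ (map (λ η → sumℚ (map (λ σ → term s σ η) (X (suc k)))) (X (suc (suc k))))) S)
      ≡⟨ Σℚ.sum-comm (λ s η → sumℚ (map (λ σ → term s σ η) (X (suc k)))) S (X (suc (suc k))) ⟩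
    sumℚ (map (λ η → sumℚ (map (λ s → sumℚ (map (λ σ → term s σ η) (X (suc k)))) S)) (X (suc (suc k))))
      ≤⟨ sumℚ-mono-≤ (X (suc (suc k))) column≤ ⟩
    sumℚ (map (λ η → (θₖ * ℕ→ℚ M) * (if dφ η then w η else 0ℚ)) (X (suc (suc k))))
      ≡⟨ Σℚ.*-distribˡ-sum (θₖ * ℕ→ℚ M) (λ η → if dφ η then w η else 0ℚ) (X (suc (suc k))) ⟨
    (θₖ * ℕ→ℚ M) * sumℚ (map (λ η → if dφ η then w η else 0ℚ) (X (suc (suc k))))
      ≡⟨ cong ((θₖ * ℕ→ℚ M) *_) (norm-as-sum (suc (suc k)) dφ) ⟨
    (θₖ * ℕ→ℚ M) * norm (suc (suc k)) dφ
      ≡⟨ trans (cong (_* norm (suc (suc k)) dφ) (ℚP.*-comm θₖ (ℕ→ℚ M))) (ℚP.*-assoc (ℕ→ℚ M) θₖ _) ⟩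
    ℕ→ℚ M * (θₖ * norm (suc (suc k)) dφ)
      ≡⟨ cong (λ m → ℕ→ℚ m * (θₖ * norm (suc (suc k)) dφ)) (length-tabulate {n = M} (λ s → s)) ⟨
    ℕ→ℚ (length S) * (θₖ * norm (suc (suc k)) dφ) ∎
    where open ℚP.≤-Reasoning

-- The bound holds for every k-cochain.
proposition2p3 : {N : ℕ} (n : ℕ) (facets : List (Subset N)) → PureComplex n facets →
    (BL : Cx.BuildingLike n facets) (𝓒 : Cx.ChainFamily n facets BL) →
    (k : ℕ) → k < n → Cx.hₖ≥1/ n facets k (Cx.θ n facets BL 𝓒 k)
proposition2p3 n facets pure BL 𝓒 k k<n φ _ =
  ≤-mean bound S (∈-length (∈-allFin (fromℕ< M-pos))) (λ {s} _ → classNorm≤bound s) sum-bound≤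
  where
  open Averaging pure BL 𝓒 k<n φ
  open Cx.BuildingLike BL
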